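{- Let $k,n,\mu$ be non-negative integers with $\mu\ge 1$. The number of sequences of $k$ balls colored in at most $n$ colors that contain exactly $\mu$ balls whose color appears earlier in the sequence is $$\sum_{\lambda=0}^{\mu} Z(k,n,\mu+\lambda,\lambda).$$
   Context: A sequence of $k$ balls colored in at most $n$ colors is a function $c:\{1,\dots,k\}\to\{1,\dots,n\}$. Ball $i$ has its color appearing earlier if there is $j<i$ with $c(j)=c(i)$. A ball $i$ matches another ball if there is $j\ne i$ with $c(j)=c(i)$; a color is repeated if it is the color of at least two balls. $Z(k,n,m,\lambda)$ denotes the number of such sequences of length $k$ in which exactly $m$ balls match some other ball and exactly $\lambda$ colors are repeated. -}

module Defs where

open import Data.Nat using (ℕ; zero; suc; _+_; _≥_; _<_)
open import Data.Nat.Properties using (_≟_)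
open import Data.Fin using (Fin; toℕ)
open import Data.Fin.Properties using (all?; any?) renaming (_≟_ to _≟ᶠ_)
open import Data.List using (List; []; _∷_; length; filter; map; concatMap; sum)
open import Data.Product using (Σ; _×_; _,_)
open import Relation.Binary.PropositionalEquality using (_≡_; _≢_)
open import Relation.Nullary using (Dec; yes; no; ¬_)
open import Relation.Nullary.Decidable using (_×-dec_; ¬?)
open import Data.Nat.Properties using (_<?_)
open import Data.List using (allFin)

-- A sequence of k balls coloured in at most n colours: c : {1..k} → {1..n},
-- represented with 0-based indices as Fin k → Fin n.
Colouring : ℕ → ℕ → Set
Colouring k n = Fin k → Fin n

allColourings : (k n : ℕ) → List (Colouring k n)
allColourings zero    n = (λ ()) ∷ []
allColourings (suc k) n =
  concatMap (λ x → map (λ c → λ { Fin.zero → x ; (Fin.suc i) → c i }) (allColourings k n))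
            (allFin n)

count : ∀ {m} {P : Fin m → Set} → ((i : Fin m) → Dec (P i)) → ℕ
count {m} P? = length (filter P? (allFin m))

AppearsEarlier : ∀ {k n} → Colouring k n → Fin k → Set
AppearsEarlier {k} c i = Σ (Fin k) λ j → (toℕ j < toℕ i) × (c j ≡ c i)

appearsEarlier? : ∀ {k n} (c : Colouring k n) (i : Fin k) → Dec (AppearsEarlier c i)
appearsEarlier? c i = any? λ j → (toℕ j <? toℕ i) ×-dec (c j ≟ᶠ c i)

Matches : ∀ {k n} → Colouring k n → Fin k → Set
Matches {k} c i = Σ (Fin k) λ j → (j ≢ i) × (c j ≡ c i)

matches? : ∀ {k n} (c : Colouring k n) (i : Fin k) → Dec (Matches c i)
matches? c i = any? λ j → ¬? (j ≟ᶠ i) ×-dec (c j ≟ᶠ c i)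

Repeated : ∀ {k n} → Colouring k n → Fin n → Set
Repeated {k} c x = Σ (Fin k) λ i → Σ (Fin k) λ j → (i ≢ j) × (c i ≡ x) × (c j ≡ x)

repeated? : ∀ {k n} (c : Colouring k n) (x : Fin n) → Dec (Repeated c x)
repeated? c x = any? λ i → any? λ j → ¬? (i ≟ᶠ j) ×-dec ((c i ≟ᶠ x) ×-dec (c j ≟ᶠ x))

earlierCount : ∀ {k n} → Colouring k n → ℕ
earlierCount c = count (appearsEarlier? c)

matchCount : ∀ {k n} → Colouring k n → ℕ
matchCount c = count (matches? c)

repeatedCount : ∀ {k n} → Colouring k n → ℕ
repeatedCount c = count (repeated? c)

Z : ℕ → ℕ → ℕ → ℕ → ℕ
Z k n m l = length (filter (λ c → (matchCount c ≟ m) ×-dec (repeatedCount c ≟ l)) (allColourings k n))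

E : ℕ → ℕ → ℕ → ℕ
E k n μ = length (filter (λ c → earlierCount c ≟ μ) (allColourings k n))

sumTo : ℕ → (ℕ → ℕ) → ℕ
sumTo zero    f = f 0
sumTo (suc m) f = sumTo m f + f (suc m)

module Submission where

-- For a colouring c write e(c), m(c) and r(c) for the number of balls whose
-- colour appears earlier, of balls matching another ball, and of repeated
-- colours.  A ball matches another one iff its colour appears earlier or it
-- is the first ball of a repeated colour, whence
--     m(c) = e(c) + r(c)    and    r(c) ≤ e(c).
-- Both facts are proved by induction on the length, removing the last ball:
-- it contributes 1 to e iff its colour x occurred before, and it raises m and
-- r by one more iff x occurred exactly once before (that earlier ball starts
-- to match and x becomes repeated).  Hence, for each c, e(c) = μ holds iff
-- (m(c), r(c)) = (μ + λ, λ) for exactly one λ ≤ μ, namely λ = r(c); summing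
-- this pointwise identity over all colourings proves the theorem.

open import Defs
open import Data.Nat using (ℕ; zero; suc; _+_; _≤_; _<_; _≥_; z≤n; s≤s)
open import Data.Nat.Properties
  using (_≟_; +-comm; +-assoc; +-mono-≤; ≤-refl; ≤-reflexive; m≤n⇒m≤1+n;
         m≤n⇒m<n∨m≡n; <-irrefl; <-asym; +-cancelʳ-≡;
         +-commutativeSemigroup; +-0-commutativeMonoid)
open import Data.Fin using (Fin; toℕ; inject₁; fromℕ)
  renaming (zero to fzero; suc to fsuc)
open import Data.Fin.Properties
  using (any?; toℕ<n; toℕ-fromℕ; toℕ-inject₁; 0≢1+n; fromℕ≢inject₁; inject₁-injective; suc-injective)
  renaming (_≟_ to _≟ᶠ_)
open import Data.List using (List; []; _∷_; length; filter; tabulate)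
open import Data.Product using (Σ; _×_; _,_; proj₁; proj₂)
open import Data.Sum using (_⊎_; inj₁; inj₂)
open import Data.Empty using (⊥-elim)
open import Function using (_∘_; id)
open import Relation.Nullary using (Dec; yes; no; ¬_)
open import Relation.Nullary.Decidable using (_×-dec_; ¬?)
open import Relation.Binary.PropositionalEquality
  using (_≡_; refl; sym; trans; cong; cong₂; subst₂; module ≡-Reasoning)
open import Algebra.Properties.CommutativeSemigroup +-commutativeSemigroup using (interchange)
open import Algebra.Properties.CommutativeMonoid.Sum +-0-commutativeMonoid
  using (sum; sum-cong-≗; ∑-distrib-+; sum-init-last; sum-replicate-zero)

open ≡-Reasoning

𝟙 : ∀ {P : Set} → Dec P → ℕ
𝟙 (yes _) = 1
𝟙 (no _)  = 0

𝟙-yes : ∀ {P : Set} → P → (p : Dec P) → 𝟙 p ≡ 1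
𝟙-yes _  (yes _) = refl
𝟙-yes x  (no ¬x) = ⊥-elim (¬x x)

𝟙-no : ∀ {P : Set} → ¬ P → (p : Dec P) → 𝟙 p ≡ 0
𝟙-no ¬x (yes x) = ⊥-elim (¬x x)
𝟙-no _  (no _)  = refl

𝟙-cong : ∀ {P Q : Set} → (P → Q) → (Q → P) → (p : Dec P) (q : Dec Q) → 𝟙 p ≡ 𝟙 q
𝟙-cong to from p (yes q) = 𝟙-yes (from q) p
𝟙-cong to from p (no ¬q) = 𝟙-no (¬q ∘ to) p

𝟙-mono : ∀ {P Q : Set} → (P → Q) → (p : Dec P) (q : Dec Q) → 𝟙 p ≤ 𝟙 q
𝟙-mono to (yes x) q = ≤-reflexive (sym (𝟙-yes (to x) q))
𝟙-mono to (no _)  q = z≤n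

𝟙-split : ∀ {P Q R : Set} → (P → Q ⊎ R) → (Q ⊎ R → P) →
          (p : Dec P) (q : Dec Q) (r : Dec (¬ Q × R)) → 𝟙 p ≡ 𝟙 q + 𝟙 r
𝟙-split to from p (yes x) r =
  trans (𝟙-yes (from (inj₁ x)) p) (cong suc (sym (𝟙-no (λ r → proj₁ r x) r)))
𝟙-split {P} {Q} {R} to from p (no ¬x) r = 𝟙-cong onlyR (from ∘ inj₂ ∘ proj₂) p r
  where
  onlyR : P → ¬ Q × R
  onlyR y with to y
  ... | inj₁ x = ⊥-elim (¬x x)
  ... | inj₂ z = ¬x , z

count-tabulate : ∀ {m M} {P : Fin M → Set} (P? : ∀ i → Dec (P i)) (g : Fin m → Fin M) →
                 length (filter P? (tabulate g)) ≡ sum (λ i → 𝟙 (P? (g i)))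
count-tabulate {zero}  P? g = refl
count-tabulate {suc m} P? g with P? (g fzero)
... | yes _ = cong suc (count-tabulate P? (g ∘ fsuc))
... | no _  = count-tabulate P? (g ∘ fsuc)

count≡sum : ∀ {m} {P : Fin m → Set} (P? : ∀ i → Dec (P i)) → count P? ≡ sum (𝟙 ∘ P?)
count≡sum P? = count-tabulate P? id

sum-𝟙-none : ∀ {m} {P : Fin m → Set} (P? : ∀ i → Dec (P i)) →
             (∀ i → ¬ P i) → sum (𝟙 ∘ P?) ≡ 0
sum-𝟙-none {m} P? ¬P = trans (sum-cong-≗ (λ i → 𝟙-no (¬P i) (P? i))) (sum-replicate-zero m)

sum-𝟙-unique : ∀ {m} {P : Fin m → Set} (P? : ∀ i → Dec (P i)) →
               (∀ i j → P i → P j → i ≡ j) → Σ (Fin m) P → sum (𝟙 ∘ P?) ≡ 1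
sum-𝟙-unique P? unique (fzero , x) =
  cong₂ _+_ (𝟙-yes x (P? fzero))
            (sum-𝟙-none (P? ∘ fsuc) (λ i y → 0≢1+n (unique fzero (fsuc i) x y)))
sum-𝟙-unique P? unique (fsuc i , x) =
  cong₂ _+_ (𝟙-no (λ y → 0≢1+n (unique fzero (fsuc i) y x)) (P? fzero))
            (sum-𝟙-unique (P? ∘ fsuc) (λ a b y z → suc-injective (unique (fsuc a) (fsuc b) y z)) (i , x))

sumTo-cong : ∀ μ {f g : ℕ → ℕ} → (∀ l → f l ≡ g l) → sumTo μ f ≡ sumTo μ g
sumTo-cong zero    f≡g = f≡g 0
sumTo-cong (suc μ) f≡g = cong₂ _+_ (sumTo-cong μ f≡g) (f≡g (suc μ))

sumTo-distrib-+ : ∀ μ (f g : ℕ → ℕ) → sumTo μ (λ l → f l + g l) ≡ sumTo μ f + sumTo μ g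
sumTo-distrib-+ zero    f g = refl
sumTo-distrib-+ (suc μ) f g = begin
  sumTo μ (λ l → f l + g l) + (f (suc μ) + g (suc μ))
    ≡⟨ cong (_+ (f (suc μ) + g (suc μ))) (sumTo-distrib-+ μ f g) ⟩
  (sumTo μ f + sumTo μ g) + (f (suc μ) + g (suc μ))
    ≡⟨ interchange (sumTo μ f) (sumTo μ g) (f (suc μ)) (g (suc μ)) ⟩
  sumTo (suc μ) f + sumTo (suc μ) g ∎

sumTo-zero : ∀ μ → sumTo μ (λ _ → 0) ≡ 0
sumTo-zero zero    = refl
sumTo-zero (suc μ) = cong (_+ 0) (sumTo-zero μ)

sumTo-𝟙-none : ∀ μ {Q : ℕ → Set} (Q? : ∀ l → Dec (Q l)) →
               (∀ l → l ≤ μ → ¬ Q l) → sumTo μ (𝟙 ∘ Q?) ≡ 0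
sumTo-𝟙-none zero    Q? ¬Q = 𝟙-no (¬Q 0 z≤n) (Q? 0)
sumTo-𝟙-none (suc μ) Q? ¬Q =
  cong₂ _+_ (sumTo-𝟙-none μ Q? (λ l l≤μ → ¬Q l (m≤n⇒m≤1+n l≤μ))) (𝟙-no (¬Q (suc μ) ≤-refl) (Q? (suc μ)))

sumTo-𝟙-single : ∀ μ r {Q : ℕ → Set} (Q? : ∀ l → Dec (Q l)) →
                 r ≤ μ → (∀ l → Q l → l ≡ r) → Q r → sumTo μ (𝟙 ∘ Q?) ≡ 1
sumTo-𝟙-single zero .zero Q? z≤n only x = 𝟙-yes x (Q? 0)
sumTo-𝟙-single (suc μ) r Q? r≤1+μ only x with m≤n⇒m<n∨m≡n r≤1+μ
... | inj₁ (s≤s r≤μ) =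
  cong₂ _+_ (sumTo-𝟙-single μ r Q? r≤μ only x)
            (𝟙-no (λ y → <-irrefl (sym (only (suc μ) y)) (s≤s r≤μ)) (Q? (suc μ)))
... | inj₂ refl =
  cong₂ _+_ (sumTo-𝟙-none μ Q? (λ l l≤μ y → <-irrefl (only l y) (s≤s l≤μ))) (𝟙-yes x (Q? (suc μ)))

length-filter-∷ : ∀ {A : Set} {R : A → Set} (R? : ∀ a → Dec (R a)) a xs →
                  length (filter R? (a ∷ xs)) ≡ 𝟙 (R? a) + length (filter R? xs)
length-filter-∷ R? a xs with R? a
... | yes _ = refl
... | no _  = refl

count-sumTo : ∀ {A : Set} {P : A → Set} {Q : ℕ → A → Set} μ
              (P? : ∀ a → Dec (P a)) (Q? : ∀ l a → Dec (Q l a)) →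
              (∀ a → 𝟙 (P? a) ≡ sumTo μ (λ l → 𝟙 (Q? l a))) →
              (xs : List A) → length (filter P? xs) ≡ sumTo μ (λ l → length (filter (Q? l) xs))
count-sumTo μ P? Q? pointwise []       = sym (sumTo-zero μ)
count-sumTo μ P? Q? pointwise (a ∷ xs) = begin
  length (filter P? (a ∷ xs))
    ≡⟨ length-filter-∷ P? a xs ⟩
  𝟙 (P? a) + length (filter P? xs)
    ≡⟨ cong₂ _+_ (pointwise a) (count-sumTo μ P? Q? pointwise xs) ⟩
  sumTo μ (λ l → 𝟙 (Q? l a)) + sumTo μ (λ l → length (filter (Q? l) xs))
    ≡⟨ sym (sumTo-distrib-+ μ _ _) ⟩
  sumTo μ (λ l → 𝟙 (Q? l a) + length (filter (Q? l) xs))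
    ≡⟨ sumTo-cong μ (λ l → sym (length-filter-∷ (Q? l) a xs)) ⟩
  sumTo μ (λ l → length (filter (Q? l) (a ∷ xs))) ∎

𝟙-level : ∀ e r m μ → m ≡ e + r → r ≤ e →
          𝟙 (e ≟ μ) ≡ sumTo μ (λ l → 𝟙 ((m ≟ μ + l) ×-dec (r ≟ l)))
𝟙-level e r m μ m≡e+r r≤e with e ≟ μ
... | yes refl = sym (sumTo-𝟙-single e r _ r≤e (λ l x → sym (proj₂ x)) (m≡e+r , refl))
... | no e≢μ   = sym (sumTo-𝟙-none μ _ (λ { l _ (m≡μ+l , refl) →
                   e≢μ (+-cancelʳ-≡ r e μ (trans (sym m≡e+r) m≡μ+l)) }))

initOrLast : ∀ {k} (j : Fin (suc k)) → (Σ (Fin k) λ j′ → j ≡ inject₁ j′) ⊎ (j ≡ fromℕ k)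
initOrLast {zero}  fzero    = inj₂ refl
initOrLast {suc k} fzero    = inj₁ (fzero , refl)
initOrLast {suc k} (fsuc j) with initOrLast j
... | inj₁ (j′ , refl) = inj₁ (fsuc j′ , refl)
... | inj₂ refl        = inj₂ refl

earlierSum matchSum repeatedSum : ∀ {k n} → Colouring k n → ℕ
earlierSum  c = sum (𝟙 ∘ appearsEarlier? c)
matchSum    c = sum (𝟙 ∘ matches? c)
repeatedSum c = sum (𝟙 ∘ repeated? c)

-- Let x be the colour of the last
-- ball; Occurs says x occurs in c′, Single that it occurs there exactly once.
module LastBall {k n} (c : Colouring (suc k) n) where

  c′ : Colouring k n
  c′ = c ∘ inject₁

  x : Fin n
  x = c (fromℕ k)

  Occurs : Set
  Occurs = Σ (Fin k) λ j → c′ j ≡ x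

  occurs? : Dec Occurs
  occurs? = any? (λ j → c′ j ≟ᶠ x)

  Single : Set
  Single = ¬ Repeated c′ x × Occurs

  single? : Dec Single
  single? = ¬? (repeated? c′ x) ×-dec occurs?

  inject₁<last : ∀ j → toℕ (inject₁ j) < toℕ (fromℕ k)
  inject₁<last j = subst₂ _<_ (sym (toℕ-inject₁ j)) (sym (toℕ-fromℕ k)) (toℕ<n j)

  -- Among the first k balls, the last ball never counts as an earlier one.
  earlier-init→ : ∀ i → AppearsEarlier c (inject₁ i) → AppearsEarlier c′ i
  earlier-init→ i (j , j<i , same) with initOrLast j
  ... | inj₁ (j′ , refl) = j′ , subst₂ _<_ (toℕ-inject₁ j′) (toℕ-inject₁ i) j<i , same
  ... | inj₂ refl        = ⊥-elim (<-asym j<i (inject₁<last i))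

  earlier-init← : ∀ i → AppearsEarlier c′ i → AppearsEarlier c (inject₁ i)
  earlier-init← i (j , j<i , same) =
    inject₁ j , subst₂ _<_ (sym (toℕ-inject₁ j)) (sym (toℕ-inject₁ i)) j<i , same

  earlier-last→ : AppearsEarlier c (fromℕ k) → Occurs
  earlier-last→ (j , j<k , same) with initOrLast j
  ... | inj₁ (j′ , refl) = j′ , same
  ... | inj₂ refl        = ⊥-elim (<-irrefl refl j<k)

  earlier-last← : Occurs → AppearsEarlier c (fromℕ k)
  earlier-last← (j , same) = inject₁ j , inject₁<last j , same

  matches-init→ : ∀ i → Matches c (inject₁ i) → Matches c′ i ⊎ c′ i ≡ x
  matches-init→ i (j , j≢i , same) with initOrLast j
  ... | inj₁ (j′ , refl) = inj₁ (j′ , (λ j′≡i → j≢i (cong inject₁ j′≡i)) , same)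
  ... | inj₂ refl        = inj₂ (sym same)

  matches-init← : ∀ i → Matches c′ i ⊎ c′ i ≡ x → Matches c (inject₁ i)
  matches-init← i (inj₁ (j , j≢i , same)) = inject₁ j , (j≢i ∘ inject₁-injective) , same
  matches-init← i (inj₂ colour-x)         = fromℕ k , fromℕ≢inject₁ , sym colour-x

  matches-last→ : Matches c (fromℕ k) → Occurs
  matches-last→ (j , j≢k , same) with initOrLast j
  ... | inj₁ (j′ , refl) = j′ , same
  ... | inj₂ refl        = ⊥-elim (j≢k refl)

  matches-last← : Occurs → Matches c (fromℕ k)
  matches-last← (j , same) = inject₁ j , (fromℕ≢inject₁ ∘ sym) , same

  repeated→ : ∀ y → Repeated c y → Repeated c′ y ⊎ (y ≡ x × Occurs)
  repeated→ y (i , j , i≢j , ci , cj) with initOrLast i | initOrLast j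
  ... | inj₁ (i′ , refl) | inj₁ (j′ , refl) = inj₁ (i′ , j′ , (i≢j ∘ cong inject₁) , ci , cj)
  ... | inj₁ (i′ , refl) | inj₂ refl        = inj₂ (sym cj , i′ , trans ci (sym cj))
  ... | inj₂ refl        | inj₁ (j′ , refl) = inj₂ (sym ci , j′ , trans cj (sym ci))
  ... | inj₂ refl        | inj₂ refl        = ⊥-elim (i≢j refl)

  repeated← : ∀ y → Repeated c′ y ⊎ (y ≡ x × Occurs) → Repeated c y
  repeated← y (inj₁ (i , j , i≢j , ci , cj)) =
    inject₁ i , inject₁ j , (i≢j ∘ inject₁-injective) , ci , cj
  repeated← y (inj₂ (refl , j , cj)) = inject₁ j , fromℕ k , (fromℕ≢inject₁ ∘ sym) , cj , refl

  -- The balls of c′ that start matching in c: they have colour x and match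
  -- nothing in c′.  There is one such ball iff x occurs exactly once in c′.
  Lonely : Fin k → Set
  Lonely i = ¬ Matches c′ i × c′ i ≡ x

  lonely? : ∀ i → Dec (Lonely i)
  lonely? i = ¬? (matches? c′ i) ×-dec (c′ i ≟ᶠ x)

  lonely-count : sum (𝟙 ∘ lonely?) ≡ 𝟙 single?
  lonely-count with repeated? c′ x | occurs?
  ... | yes (i₁ , i₂ , i₁≢i₂ , c₁ , c₂) | _ = sum-𝟙-none lonely? notLonely
    where
    notLonely : ∀ i → ¬ Lonely i
    notLonely i (unmatched , ci) with i ≟ᶠ i₁
    ... | yes refl = unmatched (i₂ , (i₁≢i₂ ∘ sym) , trans c₂ (sym ci))
    ... | no i≢i₁  = unmatched (i₁ , (i≢i₁ ∘ sym) , trans c₁ (sym ci))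
  ... | no notRepeated | yes (j , cj) = sum-𝟙-unique lonely? unique (j , unmatched , cj)
    where
    unmatched : ¬ Matches c′ j
    unmatched (j₂ , j₂≢j , same) = notRepeated (j₂ , j , j₂≢j , trans same cj , cj)
    unique : ∀ a b → Lonely a → Lonely b → a ≡ b
    unique a b (unmatched-a , ca) (_ , cb) with a ≟ᶠ b
    ... | yes a≡b = a≡b
    ... | no a≢b  = ⊥-elim (unmatched-a (b , (a≢b ∘ sym) , trans cb (sym ca)))
  ... | no _ | no absent = sum-𝟙-none lonely? (λ i lonely → absent (i , proj₂ lonely))

  NewlyRepeated : Fin n → Set
  NewlyRepeated y = ¬ Repeated c′ y × (y ≡ x × Occurs)

  newlyRepeated? : ∀ y → Dec (NewlyRepeated y)
  newlyRepeated? y = ¬? (repeated? c′ y) ×-dec ((y ≟ᶠ x) ×-dec occurs?)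

  newlyRepeated-count : sum (𝟙 ∘ newlyRepeated?) ≡ 𝟙 single?
  newlyRepeated-count with single?
  ... | yes (notRepeated , occ) =
    sum-𝟙-unique newlyRepeated? (λ a b p q → trans (proj₁ (proj₂ p)) (sym (proj₁ (proj₂ q))))
                 (x , notRepeated , refl , occ)
  ... | no notSingle =
    sum-𝟙-none newlyRepeated? (λ { y (notRepeated , refl , occ) → notSingle (notRepeated , occ) })

  earlierSum-snoc : earlierSum c ≡ earlierSum c′ + 𝟙 occurs?
  earlierSum-snoc = begin
    earlierSum c
      ≡⟨ sum-init-last (𝟙 ∘ appearsEarlier? c) ⟩
    sum (𝟙 ∘ appearsEarlier? c ∘ inject₁) + 𝟙 (appearsEarlier? c (fromℕ k))
      ≡⟨ cong₂ _+_ (sum-cong-≗ λ i → 𝟙-cong (earlier-init→ i) (earlier-init← i) _ _)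
                   (𝟙-cong earlier-last→ earlier-last← _ _) ⟩
    earlierSum c′ + 𝟙 occurs? ∎

  matchSum-snoc : matchSum c ≡ (matchSum c′ + 𝟙 single?) + 𝟙 occurs?
  matchSum-snoc = begin
    matchSum c
      ≡⟨ sum-init-last (𝟙 ∘ matches? c) ⟩
    sum (𝟙 ∘ matches? c ∘ inject₁) + 𝟙 (matches? c (fromℕ k))
      ≡⟨ cong₂ _+_ (sum-cong-≗ λ i → 𝟙-split (matches-init→ i) (matches-init← i) _ _ (lonely? i))
                   (𝟙-cong matches-last→ matches-last← _ _) ⟩
    sum (λ i → 𝟙 (matches? c′ i) + 𝟙 (lonely? i)) + 𝟙 occurs?
      ≡⟨ cong (_+ 𝟙 occurs?) (∑-distrib-+ (𝟙 ∘ matches? c′) (𝟙 ∘ lonely?)) ⟩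
    (matchSum c′ + sum (𝟙 ∘ lonely?)) + 𝟙 occurs?
      ≡⟨ cong (λ t → (matchSum c′ + t) + 𝟙 occurs?) lonely-count ⟩
    (matchSum c′ + 𝟙 single?) + 𝟙 occurs? ∎

  repeatedSum-snoc : repeatedSum c ≡ repeatedSum c′ + 𝟙 single?
  repeatedSum-snoc = begin
    repeatedSum c
      ≡⟨ sum-cong-≗ (λ y → 𝟙-split (repeated→ y) (repeated← y) _ _ (newlyRepeated? y)) ⟩
    sum (λ y → 𝟙 (repeated? c′ y) + 𝟙 (newlyRepeated? y))
      ≡⟨ ∑-distrib-+ (𝟙 ∘ repeated? c′) (𝟙 ∘ newlyRepeated?) ⟩
    repeatedSum c′ + sum (𝟙 ∘ newlyRepeated?)
      ≡⟨ cong (repeatedSum c′ +_) newlyRepeated-count ⟩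
    repeatedSum c′ + 𝟙 single? ∎

repeatedSum-empty : ∀ {n} (c : Colouring 0 n) → repeatedSum c ≡ 0
repeatedSum-empty c = sum-𝟙-none (repeated? c) (λ { y (() , _) })

-- Each repeated colour has a second ball, whose colour appears earlier;
-- inductively, the last ball adds to r only when it also adds to e.
repeated≤earlier : ∀ {k n} (c : Colouring k n) → repeatedSum c ≤ earlierSum c
repeated≤earlier {zero}  c = ≤-reflexive (repeatedSum-empty c)
repeated≤earlier {suc k} c =
  subst₂ _≤_ (sym repeatedSum-snoc) (sym earlierSum-snoc)
         (+-mono-≤ (repeated≤earlier c′) (𝟙-mono proj₂ single? occurs?))
  where open LastBall c

-- The matching balls are the balls whose colour appears earlier together
-- with the first balls of the repeated colours.
match≡earlier+repeated : ∀ {k n} (c : Colouring k n) → matchSum c ≡ earlierSum c + repeatedSum c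
match≡earlier+repeated {zero}  c = sym (repeatedSum-empty c)
match≡earlier+repeated {suc k} c = begin
  matchSum c
    ≡⟨ matchSum-snoc ⟩
  (matchSum c′ + s) + o
    ≡⟨ cong (λ t → (t + s) + o) (match≡earlier+repeated c′) ⟩
  ((e′ + r′) + s) + o
    ≡⟨ +-assoc (e′ + r′) s o ⟩
  (e′ + r′) + (s + o)
    ≡⟨ cong ((e′ + r′) +_) (+-comm s o) ⟩
  (e′ + r′) + (o + s)
    ≡⟨ interchange e′ r′ o s ⟩
  (e′ + o) + (r′ + s)
    ≡⟨ sym (cong₂ _+_ earlierSum-snoc repeatedSum-snoc) ⟩
  earlierSum c + repeatedSum c ∎
  where
  open LastBall c
  e′ = earlierSum c′
  r′ = repeatedSum c′
  s = 𝟙 single?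
  o = 𝟙 occurs?

-- The theorem: sum the per-colouring identity 𝟙-level, whose hypotheses are
-- the two facts above, over all colourings.  (It also holds for μ = 0.)
mainTheorem4 : (k n μ : ℕ) → μ ≥ 1 →
    E k n μ ≡ sumTo μ (λ l → Z k n (μ + l) l)
mainTheorem4 k n μ _ =
  count-sumTo μ (λ c → earlierCount c ≟ μ)
                (λ l c → (matchCount c ≟ μ + l) ×-dec (repeatedCount c ≟ l))
                pointwise (allColourings k n)
  where
  pointwise : ∀ (c : Colouring k n) →
              𝟙 (earlierCount c ≟ μ) ≡ sumTo μ (λ l → 𝟙 ((matchCount c ≟ μ + l) ×-dec (repeatedCount c ≟ l)))
  pointwise c rewrite count≡sum (appearsEarlier? c) | count≡sum (matches? c) | count≡sum (repeated? c) =
    𝟙-level (earlierSum c) (repeatedSum c) (matchSum c) μ (match≡earlier+repeated c) (repeated≤earlier c)
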